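{- Let $G$ and $H$ be connected graphs. Then $$D(H)\leq D(G[H])\leq D(G)\cdot D(H).$$
   Context: All graphs are finite and simple. For a graph $X$, a vertex labeling $\phi:V(X)\to\{1,\dots,r\}$ is $r$-distinguishing if the only automorphism of $X$ preserving all vertex labels (i.e. $\phi(\sigma x)=\phi(x)$ for all $x$) is the identity. The distinguishing number $D(X)$ is the least $r$ such that $X$ has an $r$-distinguishing vertex labeling. The lexicographic product $G[H]$ has vertex set $V(G)\times V(H)$, with $(a,x)$ adjacent to $(b,y)$ if and only if $ab\in E(G)$, or $a=b$ and $xy\in E(H)$. -}

module Defs where

open import Data.Nat using (ℕ; suc; _*_; _≤_)
open import Data.Fin using (Fin; remQuot)
open import Data.Fin.Permutation using (Permutation′; _⟨$⟩ʳ_)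
open import Data.Bool using (Bool; true; false; _∨_; _∧_)
open import Data.Product using (_×_; _,_; Σ; ∃)
open import Relation.Binary.PropositionalEquality using (_≡_)
open import Relation.Nullary using (¬_)

record Graph : Set where
  field
    n     : ℕ
    adj   : Fin n → Fin n → Bool
    sym   : ∀ x y → adj x y ≡ adj y x
    irrefl : ∀ x → adj x x ≡ false
open Graph public

data Walk (X : Graph) : Fin (n X) → Fin (n X) → Set where
  here  : ∀ x → Walk X x x
  step  : ∀ {x y z} → adj X x y ≡ true → Walk X y z → Walk X x z

Connected : Graph → Set
Connected X = (Σ ℕ λ k → n X ≡ suc k) × (∀ x y → Walk X x y)

-- The following notions are stated for an adjacency relation A on Fin m
-- (so they apply both to a Graph and to the lexicographic product below).

IsAutomorphism : ∀ {m} → (Fin m → Fin m → Bool) → Permutation′ m → Set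
IsAutomorphism A σ = ∀ x y → A (σ ⟨$⟩ʳ x) (σ ⟨$⟩ʳ y) ≡ A x y

Distinguishing : ∀ {m} → (Fin m → Fin m → Bool) → (r : ℕ) → (Fin m → Fin r) → Set
Distinguishing {m} A r φ =
  ∀ (σ : Permutation′ m) → IsAutomorphism A σ →
    (∀ x → φ (σ ⟨$⟩ʳ x) ≡ φ x) → ∀ x → σ ⟨$⟩ʳ x ≡ x

HasDistinguishing : ∀ {m} → (Fin m → Fin m → Bool) → ℕ → Set
HasDistinguishing {m} A r = Σ (Fin m → Fin r) (Distinguishing A r)

IsDistNumber : ∀ {m} → (Fin m → Fin m → Bool) → ℕ → Set
IsDistNumber A d = HasDistinguishing A d × (∀ r → HasDistinguishing A r → d ≤ r)

-- Lexicographic product G[H] on Fin (n G * n H); vertex i corresponds to the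
-- pair remQuot (n H) i = (a , x) with a ∈ V(G), x ∈ V(H).
lexAdj : (G H : Graph) → Fin (n G * n H) → Fin (n G * n H) → Bool
lexAdj G H i j with remQuot {n G} (n H) i | remQuot {n G} (n H) j
... | (a , x) | (b , y) = adj G a b ∨ (eqF a b ∧ adj H x y)
  where
  open import Data.Fin using (_≟_)
  open import Relation.Nullary.Decidable using (⌊_⌋)
  eqF : Fin (n G) → Fin (n G) → Bool
  eqF u v = ⌊ u ≟ v ⌋

-- Upper bound: label (a , x) by (φG a , φH x). Suppose an automorphism σ of G[H]
-- preserves this labelling. If two vertices of a layer {a} × V(H) went to different
-- layers b ≠ c, then b and c would be twins in G: an edge d b with d ∉ {b , c} carries
-- over to an edge d c unless σ⁻¹ maps the layer of d into, hence onto, the layer of a,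
-- which would give d = b. Equally labelled twins are swapped by a labelling-preserving transposition,
-- which the distinguishing labelling of G forbids. So σ permutes the layers; the
-- induced permutations of V(G) and, inside each layer, of V(H) preserve adjacency and
-- labels and are therefore trivial.
-- Lower bound: an automorphism of H acting on a single layer is an automorphism of
-- G[H], so a distinguishing labelling of G[H] restricted to one layer distinguishes H.
module Submission where

open import Data.Bool using (Bool; true; _∨_; _∧_; if_then_else_)
open import Data.Bool.Properties using (∨-identityʳ; ⇔→≡)
open import Data.Fin using (Fin; zero; combine; remQuot; punchOut; _≟_)
open import Data.Fin.Permutation
  using (Permutation′; permutation; transpose; _⟨$⟩ʳ_; _⟨$⟩ˡ_; inverseˡ; inverseʳ)
import Data.Fin.Permutation.Components as Components
open import Data.Fin.Properties
  using (any?; all?; ¬∀⟶∃¬; punchOut-injective; injective⇒≤; *↔×;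
         remQuot-combine; combine-injectiveˡ; combine-injectiveʳ)
open import Data.Nat using (ℕ; suc; _*_; _≤_)
open import Data.Nat.Properties using (1+n≰n)
open import Data.Product using (_×_; _,_; proj₁; proj₂; ∃; uncurry; map)
open import Function using (_∘_; _↔_; Inverse; mk↔ₛ′; mk⇔; Injective)
open import Function.Construct.Composition using (_↔-∘_)
open import Function.Construct.Symmetry using (↔-sym)
open import Relation.Binary.PropositionalEquality
  using (_≡_; _≢_; refl; sym; trans; cong; cong₂; subst; module ≡-Reasoning)
open import Relation.Nullary using (yes; no; contradiction)
open import Relation.Nullary.Decidable using (⌊_⌋)

open import Defs hiding (sym)
open Inverse using (to; from; strictlyInverseˡ; strictlyInverseʳ)
open ≡-Reasoning

injective⇒surjective : ∀ {m} {f : Fin m → Fin m} → Injective _≡_ _≡_ f →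
                       ∀ y → ∃ λ x → f x ≡ y
injective⇒surjective {suc k} {f} f-injective y with any? (λ x → f x ≟ y)
... | yes hit = hit
... | no miss = contradiction (injective⇒≤ f′-injective) 1+n≰n
  where
  y≢f : ∀ x → y ≢ f x
  y≢f x y≡fx = miss (x , sym y≡fx)

  f′ : Fin (suc k) → Fin k
  f′ x = punchOut (y≢f x)

  f′-injective : Injective _≡_ _≡_ f′
  f′-injective = f-injective ∘ punchOut-injective (y≢f _) (y≢f _)

-- On V = Fin m these are definitionally IsAutomorphism and the two other clauses of
-- Distinguishing from Defs, so they apply to its hypotheses directly.
module _ {V : Set} where

  IsAutomorphism′ : (V → V → Bool) → V ↔ V → Set
  IsAutomorphism′ A π = ∀ u v → A (to π u) (to π v) ≡ A u v

  Invariant : {X : Set} → (V → X) → V ↔ V → Set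
  Invariant ℓ π = ∀ v → ℓ (to π v) ≡ ℓ v

  IsIdentity : V ↔ V → Set
  IsIdentity π = ∀ v → to π v ≡ v

  module _ {A : V → V → Bool} {π : V ↔ V} (aut : IsAutomorphism′ A π) where

    IsAutomorphism′-adjoint : ∀ u v → A (from π u) v ≡ A u (to π v)
    IsAutomorphism′-adjoint u v = begin
      A (from π u) v                   ≡⟨ aut (from π u) v ⟨
      A (to π (from π u)) (to π v)     ≡⟨ cong (λ w → A w (to π v)) (strictlyInverseˡ π u) ⟩
      A u (to π v)                     ∎

    IsAutomorphism′-sym : IsAutomorphism′ A (↔-sym π)
    IsAutomorphism′-sym u v = begin
      A (from π u) (from π v)          ≡⟨ IsAutomorphism′-adjoint u (from π v) ⟩
      A u (to π (from π v))            ≡⟨ cong (A u) (strictlyInverseˡ π v) ⟩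
      A u v                            ∎

  Invariant-sym : ∀ {X : Set} {ℓ : V → X} {π : V ↔ V} →
                  Invariant ℓ π → Invariant ℓ (↔-sym π)
  Invariant-sym {ℓ = ℓ} {π} inv v = begin
    ℓ (from π v)                       ≡⟨ inv (from π v) ⟨
    ℓ (to π (from π v))                ≡⟨ cong ℓ (strictlyInverseˡ π v) ⟩
    ℓ v                                ∎

conjugate : {W V : Set} → W ↔ V → W ↔ W → V ↔ V
conjugate e σ = e ↔-∘ (σ ↔-∘ ↔-sym e)

module _ {W V : Set} (e : W ↔ V) {σ : W ↔ W} where

  IsAutomorphism′-conjugate : {B : W → W → Bool} {A : V → V → Bool} →
    (∀ i j → B i j ≡ A (to e i) (to e j)) →
    IsAutomorphism′ B σ → IsAutomorphism′ A (conjugate e σ)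
  IsAutomorphism′-conjugate {B} {A} e-iso aut u v = begin
    A (to e (to σ (from e u))) (to e (to σ (from e v)))  ≡⟨ e-iso _ _ ⟨
    B (to σ (from e u)) (to σ (from e v))                ≡⟨ aut _ _ ⟩
    B (from e u) (from e v)                              ≡⟨ e-iso _ _ ⟩
    A (to e (from e u)) (to e (from e v))
      ≡⟨ cong₂ A (strictlyInverseˡ e u) (strictlyInverseˡ e v) ⟩
    A u v                                                ∎

  Invariant-conjugate : ∀ {X : Set} {ℓ : W → X} {ℓ′ : V → X} →
    (∀ i → ℓ i ≡ ℓ′ (to e i)) → Invariant ℓ σ → Invariant ℓ′ (conjugate e σ)
  Invariant-conjugate {ℓ = ℓ} {ℓ′} ℓ-factors inv v = begin
    ℓ′ (to e (to σ (from e v)))        ≡⟨ ℓ-factors _ ⟨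
    ℓ (to σ (from e v))                ≡⟨ inv (from e v) ⟩
    ℓ (from e v)                       ≡⟨ ℓ-factors _ ⟩
    ℓ′ (to e (from e v))               ≡⟨ cong ℓ′ (strictlyInverseˡ e v) ⟩
    ℓ′ v                               ∎

  conjugate-reflectsIdentity : IsIdentity (conjugate e σ) → IsIdentity σ
  conjugate-reflectsIdentity id-conj i = begin
    to σ i                             ≡⟨ cong (to σ) (strictlyInverseʳ e i) ⟨
    to σ (from e (to e i))             ≡⟨ strictlyInverseʳ e _ ⟨
    from e (to e (to σ (from e (to e i))))  ≡⟨ cong (from e) (id-conj (to e i)) ⟩
    from e (to e i)                    ≡⟨ strictlyInverseʳ e i ⟩
    i                                  ∎

data TransposeView {m} (b c : Fin m) : Fin m → Fin m → Set where
  at-b  : TransposeView b c b c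
  at-c  : TransposeView b c c b
  apart : ∀ {k} → k ≢ b → k ≢ c → TransposeView b c k k

transpose-view : ∀ {m} (b c k : Fin m) → TransposeView b c k (Components.transpose b c k)
transpose-view b c k with k ≟ b
... | yes refl = at-b
... | no k≢b with k ≟ c
...   | yes refl = at-c
...   | no k≢c = apart k≢b k≢c

transpose-applyˡ : ∀ {m} (b c : Fin m) → Components.transpose b c b ≡ c
transpose-applyˡ b c with b ≟ b
... | yes _ = refl
... | no b≢b = contradiction refl b≢b

Twins : (G : Graph) → Fin (n G) → Fin (n G) → Set
Twins G b c = ∀ d → d ≢ b → d ≢ c → adj G d b ≡ adj G d c

module _ (G : Graph) {b c : Fin (n G)} where

  private
    loops : ∀ u v → adj G u u ≡ adj G v v
    loops u v = trans (irrefl G u) (sym (irrefl G v))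

    Twins-swap : Twins G b c → ∀ d → d ≢ b → d ≢ c → adj G b d ≡ adj G c d
    Twins-swap twins d d≢b d≢c = begin
      adj G b d  ≡⟨ Graph.sym G b d ⟩
      adj G d b  ≡⟨ twins d d≢b d≢c ⟩
      adj G d c  ≡⟨ Graph.sym G d c ⟩
      adj G c d  ∎

  transpose-isAutomorphism : Twins G b c → IsAutomorphism (adj G) (transpose b c)
  transpose-isAutomorphism twins p q
    with Components.transpose b c p | transpose-view b c p
       | Components.transpose b c q | transpose-view b c q
  ... | _ | at-b          | _ | at-b          = loops c b
  ... | _ | at-b          | _ | at-c          = Graph.sym G c b
  ... | _ | at-b          | _ | apart q≢b q≢c = sym (Twins-swap twins q q≢b q≢c)
  ... | _ | at-c          | _ | at-b          = Graph.sym G b c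
  ... | _ | at-c          | _ | at-c          = loops b c
  ... | _ | at-c          | _ | apart q≢b q≢c = Twins-swap twins q q≢b q≢c
  ... | _ | apart p≢b p≢c | _ | at-b          = sym (twins p p≢b p≢c)
  ... | _ | apart p≢b p≢c | _ | at-c          = twins p p≢b p≢c
  ... | _ | apart _ _     | _ | apart _ _     = refl

  transpose-invariant : ∀ {r} {φ : Fin (n G) → Fin r} → φ b ≡ φ c → Invariant φ (transpose b c)
  transpose-invariant {φ = φ} φb≡φc k
    with Components.transpose b c k | transpose-view b c k
  ... | _ | at-b      = sym φb≡φc
  ... | _ | at-c      = φb≡φc
  ... | _ | apart _ _ = refl

  distinguishing-separatesTwins : ∀ {r} {φ : Fin (n G) → Fin r} →
    Distinguishing (adj G) r φ → Twins G b c → φ b ≡ φ c → b ≡ c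
  distinguishing-separatesTwins dist twins φb≡φc = begin
    b                                ≡⟨ dist (transpose b c) (transpose-isAutomorphism twins)
                                              (transpose-invariant φb≡φc) b ⟨
    Components.transpose b c b       ≡⟨ transpose-applyˡ b c ⟩
    c                                ∎

fibre-into⇒onto : ∀ {A : Set} {m} (π : (A × Fin m) ↔ (A × Fin m)) {a d : A} →
  (∀ z → proj₁ (from π (d , z)) ≡ a) → ∀ x → proj₁ (to π (a , x)) ≡ d
fibre-into⇒onto {m = m} π {a} {d} into x = cong proj₁ (begin
  to π (a , x)           ≡⟨ cong (to π) hits ⟨
  to π (from π (d , z))  ≡⟨ strictlyInverseˡ π _ ⟩
  (d , z)                ∎)
  where
  h : Fin m → Fin m
  h z = proj₂ (from π (d , z))

  from-fibre : ∀ z → from π (d , z) ≡ (a , h z)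
  from-fibre z = cong (_, h z) (into z)

  h-injective : Injective _≡_ _≡_ h
  h-injective {z} {z′} hz≡hz′ = cong proj₂ (begin
    (d , z)                ≡⟨ strictlyInverseˡ π _ ⟨
    to π (from π (d , z))  ≡⟨ cong (to π) (trans (from-fibre z) (cong (a ,_) hz≡hz′)) ⟩
    to π (a , h z′)        ≡⟨ cong (to π) (from-fibre z′) ⟨
    to π (from π (d , z′)) ≡⟨ strictlyInverseˡ π _ ⟩
    (d , z′)               ∎)

  preimage : ∃ λ z → h z ≡ x
  preimage = injective⇒surjective h-injective x

  z : Fin m
  z = proj₁ preimage

  hits : from π (d , z) ≡ (a , x)
  hits = trans (from-fibre z) (cong (a ,_) (proj₂ preimage))

module _ (G H : Graph) where

  Vertex : Set
  Vertex = Fin (n G) × Fin (n H)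

  lex : Vertex → Vertex → Bool
  lex (a , x) (b , y) = adj G a b ∨ (⌊ a ≟ b ⌋ ∧ adj H x y)

  lexAdj≡lex : ∀ i j → lexAdj G H i j ≡ lex (remQuot (n H) i) (remQuot (n H) j)
  lexAdj≡lex i j with remQuot {n G} (n H) i | remQuot {n G} (n H) j
  ... | _ | _ = refl

  lex-apart : ∀ p q → proj₁ p ≢ proj₁ q → lex p q ≡ adj G (proj₁ p) (proj₁ q)
  lex-apart (a , _) (b , _) a≢b with a ≟ b
  ... | yes a≡b = contradiction a≡b a≢b
  ... | no _    = ∨-identityʳ (adj G a b)

  lex-layer : ∀ a x y → lex (a , x) (a , y) ≡ adj H x y
  lex-layer a x y with a ≟ a
  ... | yes _ rewrite irrefl G a = refl
  ... | no a≢a = contradiction refl a≢a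

  module _ (π : Vertex ↔ Vertex) (aut : IsAutomorphism′ lex π) where

    private
      adjoint : ∀ u v → lex (from π u) v ≡ lex u (to π v)
      adjoint = IsAutomorphism′-adjoint {A = lex} {π = π} aut

      layer : Vertex → Fin (n G)
      layer p = proj₁ (to π p)

      cross-edge : ∀ {a x y d z} → d ≢ layer (a , y) → adj G d (layer (a , x)) ≡ true →
                   proj₁ (from π (d , z)) ≢ a → adj G d (layer (a , y)) ≡ true
      cross-edge {a} {x} {y} {d} {z} d≢c d~b a′≢a = begin
        adj G d (layer (a , y))      ≡⟨ lex-apart (d , z) (to π (a , y)) d≢c ⟨
        lex (d , z) (to π (a , y))   ≡⟨ adjoint (d , z) (a , y) ⟨
        lex (from π (d , z)) (a , y) ≡⟨ lex-apart (from π (d , z)) (a , y) a′≢a ⟩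
        adj G a′ a                   ≡⟨ lex-apart (from π (d , z)) (a , x) a′≢a ⟨
        lex (from π (d , z)) (a , x) ≡⟨ adjoint (d , z) (a , x) ⟩
        lex (d , z) (to π (a , x))   ≡⟨ cong (_∨ _) d~b ⟩
        true                         ∎
        where
        a′ : Fin (n G)
        a′ = proj₁ (from π (d , z))

    image-layers-twins : ∀ a x y → Twins G (proj₁ (to π (a , x))) (proj₁ (to π (a , y)))
    image-layers-twins a x y d d≢b d≢c =
      ⇔→≡ (mk⇔ (towards x y d≢b d≢c) (towards y x d≢c d≢b))
      where
      towards : ∀ x y → d ≢ layer (a , x) → d ≢ layer (a , y) →
                adj G d (layer (a , x)) ≡ true → adj G d (layer (a , y)) ≡ true
      towards x y d≢b d≢c d~b with all? (λ z → proj₁ (from π (d , z)) ≟ a)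
      ... | yes into = contradiction (sym (fibre-into⇒onto π into x)) d≢b
      ... | no ¬into = cross-edge d≢c d~b (proj₂ escape)
        where
        escape : ∃ λ z → proj₁ (from π (d , z)) ≢ a
        escape = ¬∀⟶∃¬ _ _ (λ z → proj₁ (from π (d , z)) ≟ a) ¬into

  module _ {rG} {φG : Fin (n G) → Fin rG} (distG : Distinguishing (adj G) rG φG) where

    layer-constant : ∀ π → IsAutomorphism′ lex π → Invariant (φG ∘ proj₁) π →
                     ∀ a x y → proj₁ (to π (a , x)) ≡ proj₁ (to π (a , y))
    layer-constant π aut invG a x y =
      distinguishing-separatesTwins G distG (image-layers-twins π aut a x y)
        (trans (invG (a , x)) (sym (invG (a , y))))

    layers-fixed : Fin (n H) → ∀ π → IsAutomorphism′ lex π →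
                   Invariant (φG ∘ proj₁) π → ∀ a x → proj₁ (to π (a , x)) ≡ a
    layers-fixed x₀ π aut invG a x = trans (layer-constant π aut invG a x x₀) (τ-identity a)
      where
      aut⁻¹ : IsAutomorphism′ lex (↔-sym π)
      aut⁻¹ = IsAutomorphism′-sym {π = π} aut

      invG⁻¹ : Invariant (φG ∘ proj₁) (↔-sym π)
      invG⁻¹ = Invariant-sym {π = π} invG

      τ τ⁻¹ : Fin (n G) → Fin (n G)
      τ a = proj₁ (to π (a , x₀))
      τ⁻¹ b = proj₁ (from π (b , x₀))

      τ⁻¹∘τ : ∀ a → τ⁻¹ (τ a) ≡ a
      τ⁻¹∘τ a = begin
        proj₁ (from π (τ a , x₀))       ≡⟨ layer-constant (↔-sym π) aut⁻¹ invG⁻¹ (τ a) x₀ _ ⟩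
        proj₁ (from π (to π (a , x₀)))  ≡⟨ cong proj₁ (strictlyInverseʳ π _) ⟩
        a                               ∎

      τ∘τ⁻¹ : ∀ b → τ (τ⁻¹ b) ≡ b
      τ∘τ⁻¹ b = begin
        proj₁ (to π (τ⁻¹ b , x₀))       ≡⟨ layer-constant π aut invG (τ⁻¹ b) x₀ _ ⟩
        proj₁ (to π (from π (b , x₀)))  ≡⟨ cong proj₁ (strictlyInverseˡ π _) ⟩
        b                               ∎

      τ-injective : ∀ {a b} → τ a ≡ τ b → a ≡ b
      τ-injective {a} {b} τa≡τb = trans (sym (τ⁻¹∘τ a)) (trans (cong τ⁻¹ τa≡τb) (τ⁻¹∘τ b))

      τ-perm : Permutation′ (n G)
      τ-perm = permutation τ τ⁻¹ τ∘τ⁻¹ τ⁻¹∘τ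

      τ-automorphism : IsAutomorphism (adj G) τ-perm
      τ-automorphism a b with a ≟ b
      ... | yes refl = trans (irrefl G (τ a)) (sym (irrefl G a))
      ... | no a≢b = begin
        adj G (τ a) (τ b)
          ≡⟨ lex-apart (to π (a , x₀)) (to π (b , x₀)) (a≢b ∘ τ-injective) ⟨
        lex (to π (a , x₀)) (to π (b , x₀))    ≡⟨ aut (a , x₀) (b , x₀) ⟩
        lex (a , x₀) (b , x₀)                  ≡⟨ lex-apart (a , x₀) (b , x₀) a≢b ⟩
        adj G a b                              ∎

      τ-identity : ∀ a → τ a ≡ a
      τ-identity = distG τ-perm τ-automorphism (λ a → invG (a , x₀))

    module _ {rH} {φH : Fin (n H) → Fin rH} (distH : Distinguishing (adj H) rH φH) where

      lex-isIdentity : Fin (n H) → ∀ π → IsAutomorphism′ lex π →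
                       Invariant (φG ∘ proj₁) π → Invariant (φH ∘ proj₂) π → IsIdentity π
      lex-isIdentity x₀ π aut invG invH (a , x) = trans (to-layer x) (cong (a ,_) (ρ-identity x))
        where
        ρ ρ⁻¹ : Fin (n H) → Fin (n H)
        ρ x = proj₂ (to π (a , x))
        ρ⁻¹ x = proj₂ (from π (a , x))

        to-layer : ∀ x → to π (a , x) ≡ (a , ρ x)
        to-layer x = cong (_, ρ x) (layers-fixed x₀ π aut invG a x)

        from-layer : ∀ x → from π (a , x) ≡ (a , ρ⁻¹ x)
        from-layer x = cong (_, ρ⁻¹ x)
          (layers-fixed x₀ (↔-sym π) (IsAutomorphism′-sym {π = π} aut)
                        (Invariant-sym {π = π} invG) a x)

        ρ⁻¹∘ρ : ∀ x → ρ⁻¹ (ρ x) ≡ x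
        ρ⁻¹∘ρ x = cong proj₂ (begin
          (a , ρ⁻¹ (ρ x))      ≡⟨ from-layer (ρ x) ⟨
          from π (a , ρ x)     ≡⟨ cong (from π) (to-layer x) ⟨
          from π (to π (a , x)) ≡⟨ strictlyInverseʳ π _ ⟩
          (a , x)              ∎)

        ρ∘ρ⁻¹ : ∀ x → ρ (ρ⁻¹ x) ≡ x
        ρ∘ρ⁻¹ x = cong proj₂ (begin
          (a , ρ (ρ⁻¹ x))      ≡⟨ to-layer (ρ⁻¹ x) ⟨
          to π (a , ρ⁻¹ x)     ≡⟨ cong (to π) (from-layer x) ⟨
          to π (from π (a , x)) ≡⟨ strictlyInverseˡ π _ ⟩
          (a , x)              ∎)

        ρ-automorphism : IsAutomorphism (adj H) (permutation ρ ρ⁻¹ ρ∘ρ⁻¹ ρ⁻¹∘ρ)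
        ρ-automorphism x y = begin
          adj H (ρ x) (ρ y)                  ≡⟨ lex-layer a (ρ x) (ρ y) ⟨
          lex (a , ρ x) (a , ρ y)            ≡⟨ cong₂ lex (to-layer x) (to-layer y) ⟨
          lex (to π (a , x)) (to π (a , y))  ≡⟨ aut (a , x) (a , y) ⟩
          lex (a , x) (a , y)                ≡⟨ lex-layer a x y ⟩
          adj H x y                          ∎

        ρ-identity : ∀ x → ρ x ≡ x
        ρ-identity = distH (permutation ρ ρ⁻¹ ρ∘ρ⁻¹ ρ⁻¹∘ρ) ρ-automorphism (λ x → invH (a , x))

  pairing : Fin (n G * n H) ↔ Vertex
  pairing = *↔×

  productLabelling : ∀ {rG rH} → (Fin (n G) → Fin rG) → (Fin (n H) → Fin rH) →
                     Fin (n G * n H) → Fin (rG * rH)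
  productLabelling φG φH = uncurry combine ∘ map φG φH ∘ to pairing

  productLabelling-distinguishing :
    ∀ {rG rH} {φG : Fin (n G) → Fin rG} {φH : Fin (n H) → Fin rH} → Fin (n H) →
    Distinguishing (adj G) rG φG → Distinguishing (adj H) rH φH →
    Distinguishing (lexAdj G H) (rG * rH) (productLabelling φG φH)
  productLabelling-distinguishing {φG = φG} {φH} x₀ distG distH σ aut inv =
    conjugate-reflectsIdentity pairing {σ = σ}
      (lex-isIdentity distG distH x₀ π π-automorphism
        (λ p → combine-injectiveˡ (φG _) (φH _) (φG _) (φH _) (π-invariant p))
        (λ p → combine-injectiveʳ (φG _) (φH _) (φG _) (φH _) (π-invariant p)))
    where
    π : Vertex ↔ Vertex
    π = conjugate pairing σ

    π-automorphism : IsAutomorphism′ lex π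
    π-automorphism = IsAutomorphism′-conjugate pairing {σ = σ} lexAdj≡lex aut

    π-invariant : Invariant (uncurry combine ∘ map φG φH) π
    π-invariant = Invariant-conjugate pairing {σ = σ} (λ _ → refl) inv

  onLayer : Fin (n G) → (Fin (n H) → Fin (n H)) → Vertex → Vertex
  onLayer a₀ f (a , x) = a , (if ⌊ a ≟ a₀ ⌋ then f x else x)

  onLayer-base : ∀ a₀ f x → onLayer a₀ f (a₀ , x) ≡ (a₀ , f x)
  onLayer-base a₀ f x with a₀ ≟ a₀
  ... | yes _    = refl
  ... | no a≢a = contradiction refl a≢a

  onLayer-inverse : ∀ a₀ f g → (∀ x → f (g x) ≡ x) → ∀ p → onLayer a₀ f (onLayer a₀ g p) ≡ p
  onLayer-inverse a₀ _ _ f∘g (a , x) with a ≟ a₀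
  ... | yes _ = cong (a ,_) (f∘g x)
  ... | no _  = refl

  liftToLayer : Fin (n G) → Permutation′ (n H) → Vertex ↔ Vertex
  liftToLayer a₀ τ = mk↔ₛ′ (onLayer a₀ (τ ⟨$⟩ʳ_)) (onLayer a₀ (τ ⟨$⟩ˡ_))
    (onLayer-inverse a₀ (τ ⟨$⟩ʳ_) (τ ⟨$⟩ˡ_) (λ _ → inverseʳ τ))
    (onLayer-inverse a₀ (τ ⟨$⟩ˡ_) (τ ⟨$⟩ʳ_) (λ _ → inverseˡ τ))

  liftToLayer-automorphism : ∀ a₀ {τ} → IsAutomorphism (adj H) τ →
                             IsAutomorphism′ lex (liftToLayer a₀ τ)
  liftToLayer-automorphism a₀ {τ} τ-aut (a , x) (b , y) with a ≟ b
  ... | no _     = refl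
  ... | yes refl = cong (adj G a a ∨_) act-automorphism
    where
    act-automorphism : adj H (if ⌊ a ≟ a₀ ⌋ then τ ⟨$⟩ʳ x else x)
                             (if ⌊ a ≟ a₀ ⌋ then τ ⟨$⟩ʳ y else y) ≡ adj H x y
    act-automorphism with a ≟ a₀
    ... | yes _ = τ-aut x y
    ... | no _  = refl

  layerRestriction-distinguishing : ∀ {r} {Ψ : Fin (n G * n H) → Fin r} (a₀ : Fin (n G)) →
    Distinguishing (lexAdj G H) r Ψ → Distinguishing (adj H) r (λ x → Ψ (combine a₀ x))
  layerRestriction-distinguishing {Ψ = Ψ} a₀ dist τ τ-aut τ-inv x =
    cong proj₂ (trans (sym (onLayer-base a₀ (τ ⟨$⟩ʳ_) x)) (π-identity (a₀ , x)))
    where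
    π : Vertex ↔ Vertex
    π = liftToLayer a₀ τ

    unpairing : Vertex ↔ Fin (n G * n H)
    unpairing = ↔-sym pairing

    lex≡lexAdj : ∀ p q → lex p q ≡ lexAdj G H (to unpairing p) (to unpairing q)
    lex≡lexAdj (a , x) (b , y) = sym (trans (lexAdj≡lex _ _)
      (cong₂ lex (remQuot-combine a x) (remQuot-combine b y)))

    π-invariant : Invariant (Ψ ∘ uncurry combine) π
    π-invariant (a , y) with a ≟ a₀
    ... | yes refl = τ-inv y
    ... | no _     = refl

    π-identity : IsIdentity π
    π-identity = conjugate-reflectsIdentity unpairing {σ = π}
      (dist (conjugate unpairing π)
        (IsAutomorphism′-conjugate unpairing {σ = π} lex≡lexAdj
          (liftToLayer-automorphism a₀ {τ} τ-aut))
        (Invariant-conjugate unpairing {σ = π} (λ _ → refl) π-invariant))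

-- Connectedness enters the theorem only through nonemptiness.
Connected⇒vertex : ∀ {X} → Connected X → Fin (n X)
Connected⇒vertex ((_ , n≡suc) , _) = subst Fin (sym n≡suc) zero

theorem2p1 : (G H : Graph) → Connected G → Connected H →
    (dG dH dGH : ℕ) → IsDistNumber (adj G) dG → IsDistNumber (adj H) dH →
    IsDistNumber (lexAdj G H) dGH →
    (dH ≤ dGH) × (dGH ≤ dG * dH)
theorem2p1 G H G-connected H-connected dG dH dGH
           ((φG , distG) , _) ((φH , distH) , minimalH) ((Ψ , distGH) , minimalGH) =
  minimalH dGH (restricted , layerRestriction-distinguishing G H a₀ distGH) ,
  minimalGH (dG * dH) (productLabelling G H φG φH ,
                       productLabelling-distinguishing G H x₀ distG distH)
  where
  a₀ : Fin (n G)
  a₀ = Connected⇒vertex G-connected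

  x₀ : Fin (n H)
  x₀ = Connected⇒vertex H-connected

  restricted : Fin (n H) → Fin dGH
  restricted x = Ψ (combine a₀ x)
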